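{- Let $r(x)=\sum_{n\ge 0}x^{2^n-1}$. Let $(j_n)_{n\ge 0}$ be defined by $j_0=0$, $j_{2k}=j_k$, $j_{2k+1}=(-1)^k$, and $s_n=1+\sum_{0\le k\le n}j_k$. Then for every $n\ge 1$, $|H_{n+1}(1+xr(x))|=s_n-2$.
   Context: For a power series $f(x)=\sum_{i\ge 0}a_ix^i$ and $n\ge 1$, the Hankel determinant $H_n(f)$ is the determinant of the $n\times n$ matrix $(a_{i+j})_{0\le i,j\le n-1}$; $H_0(f)=1$. -}

module Defs where

open import Data.Nat as ℕ using (ℕ; zero; suc; _^_; _≟_)
open import Data.Integer as ℤ using (ℤ; +_; -_; _+_; _*_; -1ℤ; 0ℤ; 1ℤ; ∣_∣)
open import Data.Fin using (Fin; zero; suc; toℕ; punchIn)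
open import Relation.Nullary using (yes; no)

Σℤ : (n : ℕ) → (ℕ → ℤ) → ℤ
Σℤ zero    f = 0ℤ
Σℤ (suc n) f = Σℤ n f + f n

[_≡ᵇ_] : ℕ → ℕ → ℤ
[ a ≡ᵇ b ] with a ≟ b
... | yes _ = 1ℤ
... | no  _ = 0ℤ

-- Coefficient of x^m in  x r(x) = Σ_{n≥0} x^{2^n}.
-- Only terms with 2^n ≤ m, hence n < m+1, can contribute.
coeffXr : ℕ → ℤ
coeffXr m = Σℤ (suc m) (λ n → [ 2 ^ n ≡ᵇ m ])

coeffF : ℕ → ℤ
coeffF m = [ m ≡ᵇ 0 ] + coeffXr m

sumFin : (m : ℕ) → (Fin m → ℤ) → ℤ
sumFin zero    g = 0ℤ
sumFin (suc m) g = g zero + sumFin m (λ i → g (suc i))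

sgn : ℕ → ℤ
sgn zero    = 1ℤ
sgn (suc k) = - sgn k

det : (n : ℕ) → (Fin n → Fin n → ℤ) → ℤ
det zero    M = 1ℤ
det (suc n) M =
  sumFin (suc n) (λ k → sgn (toℕ k) * M zero k * det n (λ i j → M (suc i) (punchIn k j)))

hankel : (ℕ → ℤ) → ℕ → ℤ
hankel a n = det n (λ i j → a (toℕ i ℕ.+ toℕ j))

-- j_0 = 0, j_{2k} = j_k, j_{2k+1} = (-1)^k ; computed with fuel (fuel n+1 suffices).
jAux : ℕ → ℕ → ℤ
jAux zero       n = 0ℤ
jAux (suc fuel) n with n ℕ.% 2
... | zero  = jAux fuel (n ℕ./ 2)
... | suc _ = sgn (n ℕ./ 2)

jseq : ℕ → ℤ
jseq n = jAux (suc n) n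

sseq : ℕ → ℤ
sseq n = 1ℤ + Σℤ (suc n) jseq

{-# OPTIONS --safe #-}
-- Write aₖ for the coefficients of f = 1 + x r(x): a₀ = 1, aₖ = 1 when k is a power of two, and
-- aₖ = 0 otherwise. Let n = 2ᵏ + p with p < 2ᵏ, and w = 2ᵏ - 1 - p. In the Hankel matrix on the
-- indices 0, …, n, the row 2ᵏ + d (0 < d ≤ p) has a single nonzero entry, in the column 2ᵏ - d on the
-- antidiagonal i + j = 2ᵏ⁺¹, and symmetrically for the columns. Striking these p row/column pairs
-- costs a factor (-1)ᵖ and leaves the indices 0, …, w together with 2ᵏ; expanding along that border
-- gives H_{n+1} = (-1)ᵖ (H_{w+1} - G_w), where G_n, the same determinant on the indices 1, …, n,
-- satisfies G_n = (-1)ᵖ G_w. On the other side j is antisymmetric about 2ᵏ, so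
-- Σ_{i≤n} jᵢ = Σ_{i≤w} jᵢ + 1. Induction on n gives |G_n| = 1 and H_{n+1} = -G_n (s_n - 2), s_n ≥ 2.
module Submission where

open import Defs
open import Data.Nat using (ℕ; zero; suc; _^_; _≤_; _<_; z≤n; s≤s)
import Data.Nat as ℕ
import Data.Nat.Properties as ℕ
open import Data.Integer.Base as ℤ using (ℤ; +_; -_; _+_; _*_; _-_; -1ℤ; 0ℤ; 1ℤ; ∣_∣)
import Data.Integer.Properties as ℤ
open import Data.Integer.Tactic.RingSolver using (solve-∀; solve)
import Data.Nat.Tactic.RingSolver as ℕ-Solver
open import Data.Fin.Base using (Fin; zero; suc; toℕ; punchIn)
open import Data.List.Base using (List; []; _∷_; _++_; length; tabulate)
open import Data.List.Properties using (++-assoc; ++-identityʳ; length-++; tabulate-cong)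
open import Data.Product.Base using (Σ; _×_; _,_)
open import Data.Sum.Base using (inj₁; inj₂)
open import Data.Nat.Induction using (<-rec)
open import Data.Nat.DivMod using (_%_; _/_; m/n<m; m*n%n≡0; m*n/n≡m; [m+kn]%n≡m%n; +-distrib-/)
open import Relation.Nullary using (yes; no; contradiction)
open import Relation.Binary.Definitions using (tri<; tri≈; tri>)
open import Data.List.Membership.Propositional using (_∈_)
open import Data.List.Membership.Propositional.Properties using (∈-++⁺ˡ; ∈-++⁺ʳ; ∈-++⁻)
open import Data.List.Relation.Unary.Any using (here; there)
open import Function.Base using (_∘_)
open import Relation.Binary.PropositionalEquality
  using (_≡_; _≢_; refl; sym; trans; cong; cong₂; subst; module ≡-Reasoning)
open ≡-Reasoning

sgn-+ : ∀ m n → sgn (m ℕ.+ n) ≡ sgn m * sgn n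
sgn-+ zero    n = sym (ℤ.*-identityˡ (sgn n))
sgn-+ (suc m) n = trans (cong -_ (sgn-+ m n)) (ℤ.neg-distribˡ-* (sgn m) (sgn n))

sgn-square : ∀ n → sgn n * sgn n ≡ 1ℤ
sgn-square zero    = refl
sgn-square (suc n) = trans (square-neg (sgn n)) (sgn-square n)
  where
  square-neg : ∀ x → (- x) * (- x) ≡ x * x
  square-neg = solve-∀

sgn-double : ∀ n → sgn (n ℕ.+ n) ≡ 1ℤ
sgn-double n = trans (sgn-+ n n) (sgn-square n)

-- laplace e C g = Σₖ (-1)ᵏ e(cₖ) g(C without cₖ): expansion along a row with entries e,
-- g returning the complementary minors.
laplace : (ℕ → ℤ) → List ℕ → (List ℕ → ℤ) → ℤ
laplace e []      g = 0ℤ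
laplace e (c ∷ C) g = e c * g C - laplace e C (g ∘ (c ∷_))

-- 0 when R and C have different lengths.
minor : (ℕ → ℕ → ℤ) → List ℕ → List ℕ → ℤ
minor M []      []      = 1ℤ
minor M []      (_ ∷ _) = 0ℤ
minor M (r ∷ R) C       = laplace (M r) C (minor M R)

flip-sign : ∀ {x} s v → x ≡ 0ℤ → x - s * v ≡ - s * v
flip-sign s v refl = negate s v
  where
  negate : ∀ s v → 0ℤ - s * v ≡ - s * v
  negate = solve-∀

module _ (e : ℕ → ℤ) where

  laplace-cong : ∀ C {g h : List ℕ → ℤ} → (∀ l → g l ≡ h l) → laplace e C g ≡ laplace e C h
  laplace-cong []      g≡h = refl
  laplace-cong (c ∷ C) g≡h = cong₂ (λ u v → e c * u - v) (g≡h C) (laplace-cong C (g≡h ∘ (c ∷_)))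

  laplace-zeroʳ : ∀ C {g : List ℕ → ℤ} → (∀ l → g l ≡ 0ℤ) → laplace e C g ≡ 0ℤ
  laplace-zeroʳ []      g≡0 = refl
  laplace-zeroʳ (c ∷ C) g≡0 =
    trans (cong₂ (λ u v → e c * u - v) (g≡0 C) (laplace-zeroʳ C (g≡0 ∘ (c ∷_))))
          (cong (_+ 0ℤ) (ℤ.*-zeroʳ (e c)))

  laplace-zeroˡ : ∀ C {g : List ℕ → ℤ} → (∀ c → c ∈ C → e c ≡ 0ℤ) → laplace e C g ≡ 0ℤ
  laplace-zeroˡ []      e≡0 = refl
  laplace-zeroˡ (c ∷ C) e≡0 =
    cong₂ (λ u v → u * _ - v) (e≡0 c (here refl)) (laplace-zeroˡ C (λ c′ → e≡0 c′ ∘ there))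

  laplace-zero-at : ∀ {c} C {g : List ℕ → ℤ} → c ∈ C → e c ≡ 0ℤ → (∀ l → c ∈ l → g l ≡ 0ℤ) →
                    laplace e C g ≡ 0ℤ
  laplace-zero-at (c ∷ C) (here refl) ec≡0 g≡0 =
    cong₂ (λ u v → u * _ - v) ec≡0 (laplace-zeroʳ C (λ l → g≡0 (c ∷ l) (here refl)))
  laplace-zero-at (c′ ∷ C) (there c∈C) ec≡0 g≡0 =
    trans (cong₂ (λ u v → e c′ * u - v) (g≡0 C c∈C)
                 (laplace-zero-at C c∈C ec≡0 (λ l → g≡0 (c′ ∷ l) ∘ there)))
          (cong (_+ 0ℤ) (ℤ.*-zeroʳ (e c′)))

  laplace-scale : ∀ C k (g : List ℕ → ℤ) → laplace e C (λ l → k * g l) ≡ k * laplace e C g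
  laplace-scale []      k g = sym (ℤ.*-zeroʳ k)
  laplace-scale (c ∷ C) k g =
    trans (cong (λ v → e c * (k * g C) - v) (laplace-scale C k (g ∘ (c ∷_))))
          (factor (e c) k (g C) (laplace e C (g ∘ (c ∷_))))
    where
    factor : ∀ x k u p → x * (k * u) - k * p ≡ k * (x * u - p)
    factor = solve-∀

  laplace-scale-sub : ∀ C k (g h : List ℕ → ℤ) →
                      laplace e C (λ l → k * g l - h l) ≡ k * laplace e C g - laplace e C h
  laplace-scale-sub []      k g h = solve (k ∷ [])
  laplace-scale-sub (c ∷ C) k g h =
    trans (cong (λ v → e c * (k * g C - h C) - v) (laplace-scale-sub C k (g ∘ (c ∷_)) (h ∘ (c ∷_))))
          (regroup (e c) k (g C) (h C) (laplace e C (g ∘ (c ∷_))) (laplace e C (h ∘ (c ∷_))))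
    where
    regroup : ∀ x k u v p q → x * (k * u - v) - (k * p - q) ≡ k * (x * u - p) - (x * v - q)
    regroup = solve-∀

  laplace-single-entry : ∀ C₁ c C₂ {g : List ℕ → ℤ} → (∀ x → x ∈ C₁ ++ C₂ → e x ≡ 0ℤ) →
                         laplace e (C₁ ++ c ∷ C₂) g ≡ sgn (length C₁) * (e c * g (C₁ ++ C₂))
  laplace-single-entry []       c C₂ e≡0 =
    trans (cong (_-_ (e c * _)) (laplace-zeroˡ C₂ e≡0))
          (trans (ℤ.+-identityʳ _) (sym (ℤ.*-identityˡ _)))
  laplace-single-entry (y ∷ C₁) c C₂ {g} e≡0 =
    trans (cong (_-_ (e y * g (C₁ ++ c ∷ C₂))) (laplace-single-entry C₁ c C₂ (λ x → e≡0 x ∘ there)))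
          (flip-sign (sgn (length C₁)) _
                     (trans (cong (_* _) (e≡0 y (here refl))) (ℤ.*-zeroˡ (g (C₁ ++ c ∷ C₂)))))

  laplace-single-minor : ∀ C₁ c C₂ {g : List ℕ → ℤ} → (∀ l → c ∈ l → g l ≡ 0ℤ) →
                         laplace e (C₁ ++ c ∷ C₂) g ≡ sgn (length C₁) * (e c * g (C₁ ++ C₂))
  laplace-single-minor []       c C₂ g≡0 =
    trans (cong (_-_ (e c * _)) (laplace-zeroʳ C₂ (λ l → g≡0 (c ∷ l) (here refl))))
          (trans (ℤ.+-identityʳ _) (sym (ℤ.*-identityˡ _)))
  laplace-single-minor (y ∷ C₁) c C₂ {g} g≡0 =
    trans (cong (_-_ (e y * g (C₁ ++ c ∷ C₂))) (laplace-single-minor C₁ c C₂ (λ l → g≡0 (y ∷ l) ∘ there)))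
          (flip-sign (sgn (length C₁)) _
                     (trans (cong (e y *_) (g≡0 _ (∈-++⁺ʳ C₁ (here refl)))) (ℤ.*-zeroʳ (e y))))

laplace-swap : ∀ e₁ e₂ C (g : List ℕ → ℤ) →
               laplace e₁ C (λ l → laplace e₂ l g) ≡ - laplace e₂ C (λ l → laplace e₁ l g)
laplace-swap e₁ e₂ []      g = refl
laplace-swap e₁ e₂ (c ∷ C) g = begin
  e₁ c * laplace e₂ C g - laplace e₁ C (λ l → e₂ c * g l - laplace e₂ l g′)
    ≡⟨ cong (_-_ (e₁ c * laplace e₂ C g)) (laplace-scale-sub e₁ C (e₂ c) g (λ l → laplace e₂ l g′)) ⟩
  e₁ c * laplace e₂ C g - (e₂ c * laplace e₁ C g - laplace e₁ C (λ l → laplace e₂ l g′))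
    ≡⟨ cong (λ v → e₁ c * laplace e₂ C g - (e₂ c * laplace e₁ C g - v)) (laplace-swap e₁ e₂ C g′) ⟩
  e₁ c * laplace e₂ C g - (e₂ c * laplace e₁ C g - - laplace e₂ C (λ l → laplace e₁ l g′))
    ≡⟨ regroup (e₁ c) (laplace e₂ C g) (e₂ c) (laplace e₁ C g) _ ⟩
  - (e₂ c * laplace e₁ C g - (e₁ c * laplace e₂ C g - laplace e₂ C (λ l → laplace e₁ l g′)))
    ≡⟨ cong (λ v → - (e₂ c * laplace e₁ C g - v)) (laplace-scale-sub e₂ C (e₁ c) g (λ l → laplace e₁ l g′)) ⟨
  - (e₂ c * laplace e₁ C g - laplace e₂ C (λ l → e₁ c * g l - laplace e₁ l g′))
    ∎
  where
  g′ = g ∘ (c ∷_)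
  regroup : ∀ a b c d x → a * b - (c * d - - x) ≡ - (c * d - (a * b - x))
  regroup = solve-∀

sign-merge : ∀ m n x → sgn m * (sgn n * x) ≡ sgn (m ℕ.+ n) * x
sign-merge m n x = trans (sym (ℤ.*-assoc (sgn m) (sgn n) x)) (cong (_* x) (sym (sgn-+ m n)))

module _ (M : ℕ → ℕ → ℤ) where

  minor-swap-rows : ∀ r r′ R C → minor M (r ∷ r′ ∷ R) C ≡ - minor M (r′ ∷ r ∷ R) C
  minor-swap-rows r r′ R C = laplace-swap (M r) (M r′) C (minor M R)

  minor-move-row : ∀ R₁ r R₂ C → minor M (R₁ ++ r ∷ R₂) C ≡ sgn (length R₁) * minor M (r ∷ R₁ ++ R₂) C
  minor-move-row []       r R₂ C = sym (ℤ.*-identityˡ _)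
  minor-move-row (x ∷ R₁) r R₂ C = begin
    laplace (M x) C (minor M (R₁ ++ r ∷ R₂))
      ≡⟨ laplace-cong (M x) C (minor-move-row R₁ r R₂) ⟩
    laplace (M x) C (λ l → s * minor M (r ∷ R₁ ++ R₂) l)
      ≡⟨ laplace-scale (M x) C s (minor M (r ∷ R₁ ++ R₂)) ⟩
    s * minor M (x ∷ r ∷ R₁ ++ R₂) C
      ≡⟨ cong (s *_) (minor-swap-rows x r (R₁ ++ R₂) C) ⟩
    s * - minor M (r ∷ x ∷ R₁ ++ R₂) C
      ≡⟨ ℤ.neg-distribʳ-* s _ ⟨
    - (s * minor M (r ∷ x ∷ R₁ ++ R₂) C)
      ≡⟨ ℤ.neg-distribˡ-* s _ ⟩
    - s * minor M (r ∷ x ∷ R₁ ++ R₂) C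
      ∎
    where s = sgn (length R₁)

  minor-zero-column : ∀ R {C c} → c ∈ C → (∀ r → r ∈ R → M r c ≡ 0ℤ) → minor M R C ≡ 0ℤ
  minor-zero-column []      {_ ∷ _} c∈C col≡0 = refl
  minor-zero-column (r ∷ R) {C}     c∈C col≡0 =
    laplace-zero-at (M r) C c∈C (col≡0 r (here refl))
      (λ l c∈l → minor-zero-column R c∈l (λ r′ → col≡0 r′ ∘ there))

  minor-single-row : ∀ R₁ r R₂ C₁ c C₂ → (∀ x → x ∈ C₁ ++ C₂ → M r x ≡ 0ℤ) →
    minor M (R₁ ++ r ∷ R₂) (C₁ ++ c ∷ C₂)
      ≡ sgn (length R₁ ℕ.+ length C₁) * (M r c * minor M (R₁ ++ R₂) (C₁ ++ C₂))
  minor-single-row R₁ r R₂ C₁ c C₂ row≡0 =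
    trans (minor-move-row R₁ r R₂ _)
          (trans (cong (sgn (length R₁) *_) (laplace-single-entry (M r) C₁ c C₂ row≡0))
                 (sign-merge (length R₁) (length C₁) _))

  minor-single-column : ∀ R₁ r R₂ C₁ c C₂ → (∀ x → x ∈ R₁ ++ R₂ → M x c ≡ 0ℤ) →
    minor M (R₁ ++ r ∷ R₂) (C₁ ++ c ∷ C₂)
      ≡ sgn (length R₁ ℕ.+ length C₁) * (M r c * minor M (R₁ ++ R₂) (C₁ ++ C₂))
  minor-single-column R₁ r R₂ C₁ c C₂ col≡0 =
    trans (minor-move-row R₁ r R₂ _)
          (trans (cong (sgn (length R₁) *_)
                       (laplace-single-minor (M r) C₁ c C₂ (λ l c∈l → minor-zero-column (R₁ ++ R₂) c∈l col≡0)))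
                 (sign-merge (length R₁) (length C₁) _))

  minor-pair-elim : ∀ A x B y →
    (∀ z → z ∈ A ++ B ++ y ∷ [] → M y z ≡ 0ℤ) → (∀ z → z ∈ A ++ B → M z y ≡ 0ℤ) →
    minor M (A ++ x ∷ B ++ y ∷ []) (A ++ x ∷ B ++ y ∷ []) ≡ - (M y x * M x y) * minor M (A ++ B) (A ++ B)
  minor-pair-elim A x B y row≡0 col≡0 = begin
    minor M (A ++ x ∷ B ++ y ∷ []) (A ++ x ∷ B ++ y ∷ [])
      ≡⟨ cong (λ R → minor M R (A ++ x ∷ B ++ y ∷ [])) (++-assoc A (x ∷ B) (y ∷ [])) ⟨
    minor M ((A ++ x ∷ B) ++ y ∷ []) (A ++ x ∷ B ++ y ∷ [])
      ≡⟨ minor-single-row (A ++ x ∷ B) y [] A x (B ++ y ∷ []) row≡0 ⟩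
    s₁ * (M y x * minor M ((A ++ x ∷ B) ++ []) (A ++ B ++ y ∷ []))
      ≡⟨ cong₂ (λ R C → s₁ * (M y x * minor M R C)) (++-identityʳ (A ++ x ∷ B)) (sym (++-assoc A B (y ∷ []))) ⟩
    s₁ * (M y x * minor M (A ++ x ∷ B) ((A ++ B) ++ y ∷ []))
      ≡⟨ cong (λ v → s₁ * (M y x * v)) (minor-single-column A x B (A ++ B) y [] col≡0) ⟩
    s₁ * (M y x * (s₂ * (M x y * minor M (A ++ B) ((A ++ B) ++ []))))
      ≡⟨ cong (λ C → s₁ * (M y x * (s₂ * (M x y * minor M (A ++ B) C)))) (++-identityʳ (A ++ B)) ⟩
    s₁ * (M y x * (s₂ * (M x y * D)))
      ≡⟨ regroup s₁ s₂ (M y x) (M x y) D ⟩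
    s₁ * s₂ * (M y x * M x y * D)
      ≡⟨ cong (_* (M y x * M x y * D)) opposite-signs ⟩
    -1ℤ * (M y x * M x y * D)
      ≡⟨ negate (M y x * M x y) D ⟩
    - (M y x * M x y) * D
      ∎
    where
    D  = minor M (A ++ B) (A ++ B)
    s₁ = sgn (length (A ++ x ∷ B) ℕ.+ length A)
    s₂ = sgn (length A ℕ.+ length (A ++ B))
    regroup : ∀ s t u v d → s * (u * (t * (v * d))) ≡ s * t * (u * v * d)
    regroup = solve-∀
    negate : ∀ w d → -1ℤ * (w * d) ≡ - w * d
    negate = solve-∀
    opposite-signs : s₁ * s₂ ≡ -1ℤ
    opposite-signs = begin
      s₁ * s₂
        ≡⟨ sgn-+ (length (A ++ x ∷ B) ℕ.+ length A) (length A ℕ.+ length (A ++ B)) ⟨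
      sgn (length (A ++ x ∷ B) ℕ.+ length A ℕ.+ (length A ℕ.+ length (A ++ B)))
        ≡⟨ cong₂ (λ m n → sgn (m ℕ.+ length A ℕ.+ (length A ℕ.+ n))) (length-++ A) (length-++ A) ⟩
      sgn (length A ℕ.+ suc (length B) ℕ.+ length A ℕ.+ (length A ℕ.+ (length A ℕ.+ length B)))
        ≡⟨ cong sgn (twice-plus-one (length A) (length B)) ⟩
      - sgn (k ℕ.+ k)
        ≡⟨ cong -_ (sgn-double k) ⟩
      -1ℤ
        ∎
      where
      k = length A ℕ.+ length A ℕ.+ length B
      twice-plus-one : ∀ a b → a ℕ.+ suc b ℕ.+ a ℕ.+ (a ℕ.+ (a ℕ.+ b))
                             ≡ suc ((a ℕ.+ a ℕ.+ b) ℕ.+ (a ℕ.+ a ℕ.+ b))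
      twice-plus-one = ℕ-Solver.solve-∀

  minor-border : ∀ X e → (∀ z → z ∈ X → M e z ≡ 0ℤ) →
                 minor M (X ++ e ∷ []) (X ++ e ∷ []) ≡ M e e * minor M X X
  minor-border X e row≡0 = begin
    minor M (X ++ e ∷ []) (X ++ e ∷ [])
      ≡⟨ minor-single-row X e [] X e [] (λ z → row≡0 z ∘ subst (z ∈_) (++-identityʳ X)) ⟩
    sgn (length X ℕ.+ length X) * (M e e * minor M (X ++ []) (X ++ []))
      ≡⟨ cong₂ (λ s R → s * (M e e * minor M R R)) (sgn-double (length X)) (++-identityʳ X) ⟩
    1ℤ * (M e e * minor M X X)
      ≡⟨ ℤ.*-identityˡ (M e e * minor M X X) ⟩
    M e e * minor M X X
      ∎

  minor-border-corner : ∀ o X e → (∀ z → z ∈ X → M e z ≡ 0ℤ) → (∀ z → z ∈ X → M z e ≡ 0ℤ) →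
    minor M (o ∷ X ++ e ∷ []) (o ∷ X ++ e ∷ [])
      ≡ M e e * minor M (o ∷ X) (o ∷ X) - M e o * M o e * minor M X X
  minor-border-corner o X e row≡0 col≡0 = begin
    minor M ((o ∷ X) ++ e ∷ []) C
      ≡⟨ minor-move-row (o ∷ X) e [] C ⟩
    - s * minor M (e ∷ (o ∷ X) ++ []) C
      ≡⟨ cong (λ R → - s * minor M (e ∷ R) C) (++-identityʳ (o ∷ X)) ⟩
    - s * (M e o * minor M (o ∷ X) (X ++ e ∷ []) - laplace (M e) (X ++ e ∷ []) (minor M (o ∷ X) ∘ (o ∷_)))
      ≡⟨ cong₂ (λ u v → - s * (M e o * u - v))
               (minor-single-column [] o X X e [] col≡0)
               (laplace-single-entry (M e) X e [] (λ z → row≡0 z ∘ subst (z ∈_) (++-identityʳ X))) ⟩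
    - s * (M e o * (s * (M o e * minor M X (X ++ []))) - s * (M e e * minor M (o ∷ X) (o ∷ X ++ [])))
      ≡⟨ cong (λ R → - s * (M e o * (s * (M o e * minor M X R))
                          - s * (M e e * minor M (o ∷ X) (o ∷ R)))) (++-identityʳ X) ⟩
    - s * (M e o * (s * (M o e * G)) - s * (M e e * H))
      ≡⟨ regroup s (M e o) (M o e) (M e e) G H ⟩
    s * s * (M e e * H) - s * s * (M e o * M o e * G)
      ≡⟨ cong (λ t → t * (M e e * H) - t * (M e o * M o e * G)) (sgn-square (length X)) ⟩
    1ℤ * (M e e * H) - 1ℤ * (M e o * M o e * G)
      ≡⟨ cong₂ _-_ (ℤ.*-identityˡ (M e e * H)) (ℤ.*-identityˡ (M e o * M o e * G)) ⟩
    M e e * H - M e o * M o e * G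
      ∎
    where
    C = o ∷ X ++ e ∷ []
    s = sgn (length X)
    G = minor M X X
    H = minor M (o ∷ X) (o ∷ X)
    regroup : ∀ s u v w g h → - s * (u * (s * (v * g)) - s * (w * h)) ≡ s * s * (w * h) - s * s * (u * v * g)
    regroup = solve-∀

sumFin-cong : ∀ m {h h′ : Fin m → ℤ} → (∀ i → h i ≡ h′ i) → sumFin m h ≡ sumFin m h′
sumFin-cong zero    h≡h′ = refl
sumFin-cong (suc m) h≡h′ = cong₂ _+_ (h≡h′ zero) (sumFin-cong m (h≡h′ ∘ suc))

sumFin-neg : ∀ m (h : Fin m → ℤ) → sumFin m (λ i → - h i) ≡ - sumFin m h
sumFin-neg zero    h = refl
sumFin-neg (suc m) h =
  trans (cong (_+_ (- h zero)) (sumFin-neg m (h ∘ suc))) (sym (ℤ.neg-distrib-+ (h zero) _))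

laplace-tabulate : ∀ n e (g : Fin (suc n) → ℕ) (Φ : List ℕ → ℤ) →
  laplace e (tabulate g) Φ ≡ sumFin (suc n) (λ k → sgn (toℕ k) * e (g k) * Φ (tabulate (g ∘ punchIn k)))
laplace-tabulate zero    e g Φ = single (e (g zero)) (Φ [])
  where
  single : ∀ x y → x * y - 0ℤ ≡ 1ℤ * x * y + 0ℤ
  single = solve-∀
laplace-tabulate (suc n) e g Φ = begin
  e (g zero) * Φ (tabulate (g ∘ suc)) - laplace e (tabulate (g ∘ suc)) (Φ ∘ (g zero ∷_))
    ≡⟨ cong (_-_ (e (g zero) * Φ (tabulate (g ∘ suc)))) (laplace-tabulate n e (g ∘ suc) (Φ ∘ (g zero ∷_))) ⟩
  e (g zero) * Φ (tabulate (g ∘ suc)) - sumFin (suc n) T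
    ≡⟨ cong (_+_ (e (g zero) * Φ (tabulate (g ∘ suc)))) (sumFin-neg (suc n) T) ⟨
  e (g zero) * Φ (tabulate (g ∘ suc)) + sumFin (suc n) (λ k → - T k)
    ≡⟨ cong₂ _+_ (cong (_* Φ (tabulate (g ∘ suc))) (sym (ℤ.*-identityˡ (e (g zero)))))
                 (sumFin-cong (suc n) (λ k → neg-sign (sgn (toℕ k)) (e (g (suc k)))
                                                     (Φ (tabulate (g ∘ punchIn (suc k)))))) ⟩
  1ℤ * e (g zero) * Φ (tabulate (g ∘ suc))
    + sumFin (suc n) (λ k → - sgn (toℕ k) * e (g (suc k)) * Φ (tabulate (g ∘ punchIn (suc k))))
    ∎
  where
  T : Fin (suc n) → ℤ
  T k = sgn (toℕ k) * e (g (suc k)) * Φ (g zero ∷ tabulate (g ∘ suc ∘ punchIn k))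
  neg-sign : ∀ s x y → - (s * x * y) ≡ - s * x * y
  neg-sign = solve-∀

det-tabulate : ∀ M n (f g : Fin n → ℕ) → det n (λ i j → M (f i) (g j)) ≡ minor M (tabulate f) (tabulate g)
det-tabulate M zero    f g = refl
det-tabulate M (suc n) f g =
  trans (sumFin-cong (suc n) (λ k → cong (sgn (toℕ k) * M (f zero) (g k) *_)
                                          (det-tabulate M n (f ∘ suc) (g ∘ punchIn k))))
        (sym (laplace-tabulate n (M (f zero)) g (minor M (tabulate (f ∘ suc)))))

range : ℕ → ℕ → List ℕ
range s zero    = []
range s (suc n) = s ∷ range (suc s) n

tabulate-range : ∀ n s → tabulate {n = n} (λ i → s ℕ.+ toℕ i) ≡ range s n
tabulate-range zero    s = refl
tabulate-range (suc n) s =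
  cong₂ _∷_ (ℕ.+-identityʳ s)
            (trans (tabulate-cong (λ i → ℕ.+-suc s (toℕ i))) (tabulate-range n (suc s)))

range-++ : ∀ s m n → range s (m ℕ.+ n) ≡ range s m ++ range (s ℕ.+ m) n
range-++ s zero    n = cong (λ t → range t n) (sym (ℕ.+-identityʳ s))
range-++ s (suc m) n =
  cong (s ∷_) (trans (range-++ (suc s) m n) (cong (λ t → range (suc s) m ++ range t n) (sym (ℕ.+-suc s m))))

range-∷ʳ : ∀ s n → range s (suc n) ≡ range s n ++ (s ℕ.+ n) ∷ []
range-∷ʳ s n = trans (cong (range s) (ℕ.+-comm 1 n)) (range-++ s n 1)

∈-range⁻ : ∀ {z} s n → z ∈ range s n → Σ ℕ λ i → i < n × z ≡ s ℕ.+ i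
∈-range⁻ s (suc n) (here refl) = 0 , s≤s z≤n , sym (ℕ.+-identityʳ s)
∈-range⁻ s (suc n) (there z∈) with ∈-range⁻ (suc s) n z∈
... | i , i<n , refl = suc i , s≤s i<n , sym (ℕ.+-suc s i)

∈-range-< : ∀ {z} s n → z ∈ range s n → z < s ℕ.+ n
∈-range-< s n z∈ with ∈-range⁻ s n z∈
... | i , i<n , refl = ℕ.+-monoʳ-< s i<n

hankelMatrix : (ℕ → ℤ) → ℕ → ℕ → ℤ
hankelMatrix a i j = a (i ℕ.+ j)

hankel-minor : ∀ a n → hankel a n ≡ minor (hankelMatrix a) (range 0 n) (range 0 n)
hankel-minor a n =
  trans (det-tabulate (hankelMatrix a) n toℕ toℕ)
        (cong₂ (minor (hankelMatrix a)) (tabulate-range n 0) (tabulate-range n 0))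

iverson-refl : ∀ a → [ a ≡ᵇ a ] ≡ 1ℤ
iverson-refl a with a ℕ.≟ a
... | yes _  = refl
... | no a≢a = contradiction refl a≢a

iverson-≢ : ∀ {a b} → a ≢ b → [ a ≡ᵇ b ] ≡ 0ℤ
iverson-≢ {a} {b} a≢b with a ℕ.≟ b
... | yes a≡b = contradiction a≡b a≢b
... | no _    = refl

Σℤ-zero : ∀ k f → (∀ i → i < k → f i ≡ 0ℤ) → Σℤ k f ≡ 0ℤ
Σℤ-zero zero    f f≡0 = refl
Σℤ-zero (suc k) f f≡0 =
  cong₂ _+_ (Σℤ-zero k f (λ i → f≡0 i ∘ ℕ.m<n⇒m<1+n)) (f≡0 k ℕ.≤-refl)

Σℤ-single : ∀ k f j → j < k → f j ≡ 1ℤ → (∀ i → i < k → i ≢ j → f i ≡ 0ℤ) → Σℤ k f ≡ 1ℤ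
Σℤ-single (suc k) f j j<1+k fj≡1 f≡0 with j ℕ.≟ k
... | yes refl =
  cong₂ _+_ (Σℤ-zero k f (λ i i<k → f≡0 i (ℕ.m<n⇒m<1+n i<k) (ℕ.<⇒≢ i<k))) fj≡1
... | no j≢k =
  cong₂ _+_ (Σℤ-single k f j (ℕ.≤∧≢⇒< (ℕ.≤-pred j<1+k) j≢k) fj≡1 (λ i → f≡0 i ∘ ℕ.m<n⇒m<1+n))
            (f≡0 k ℕ.≤-refl (j≢k ∘ sym))

2^-double : ∀ m → 2 ^ suc m ≡ 2 ^ m ℕ.+ 2 ^ m
2^-double m = cong (2 ^ m ℕ.+_) (ℕ.+-identityʳ (2 ^ m))

2^-mono-< : ∀ {i j} → i < j → 2 ^ i < 2 ^ j
2^-mono-< = ℕ.^-monoʳ-< 2 (s≤s (s≤s z≤n))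

2^-injective : ∀ {i j} → 2 ^ i ≡ 2 ^ j → i ≡ j
2^-injective {i} {j} 2^i≡2^j with ℕ.<-cmp i j
... | tri< i<j _ _ = contradiction 2^i≡2^j (ℕ.<⇒≢ (2^-mono-< i<j))
... | tri≈ _ i≡j _ = i≡j
... | tri> _ _ j<i = contradiction (sym 2^i≡2^j) (ℕ.<⇒≢ (2^-mono-< j<i))

n<2^n : ∀ n → n < 2 ^ n
n<2^n zero    = s≤s z≤n
n<2^n (suc n) = ℕ.+-mono-≤ (ℕ.m^n>0 2 n) (ℕ.≤-trans (n<2^n n) (ℕ.m≤m+n (2 ^ n) 0))

2^-gap : ∀ {m k} → 2 ^ m < k → k < 2 ^ suc m → ∀ i → 2 ^ i ≢ k
2^-gap {m} 2^m<k k<2^1+m i refl with ℕ.≤-<-connex i m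
... | inj₁ i≤m  = ℕ.<⇒≱ 2^m<k (ℕ.^-monoʳ-≤ 2 i≤m)
... | inj₂ m<i  = ℕ.<⇒≱ k<2^1+m (ℕ.^-monoʳ-≤ 2 m<i)

coeffF-pow : ∀ m → coeffF (2 ^ m) ≡ 1ℤ
coeffF-pow m = cong₂ _+_ (iverson-≢ (ℕ.>⇒≢ (ℕ.m^n>0 2 m)))
  (Σℤ-single (suc (2 ^ m)) (λ n → [ 2 ^ n ≡ᵇ 2 ^ m ]) m (ℕ.m<n⇒m<1+n (n<2^n m)) (iverson-refl (2 ^ m))
             (λ i _ i≢m → iverson-≢ (i≢m ∘ 2^-injective)))

coeffF-gap : ∀ m k → 2 ^ m < k → k < 2 ^ suc m → coeffF k ≡ 0ℤ
coeffF-gap m k 2^m<k k<2^1+m = cong₂ _+_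
  (iverson-≢ (ℕ.>⇒≢ (ℕ.≤-<-trans z≤n 2^m<k)))
  (Σℤ-zero (suc k) (λ n → [ 2 ^ n ≡ᵇ k ]) (λ i _ → iverson-≢ (2^-gap {m} 2^m<k k<2^1+m i)))

coeffF-above : ∀ m t → 0 < t → t < 2 ^ m → coeffF (2 ^ m ℕ.+ t) ≡ 0ℤ
coeffF-above m t 0<t t<2^m = coeffF-gap m (2 ^ m ℕ.+ t) (ℕ.m<m+n (2 ^ m) 0<t)
  (subst (2 ^ m ℕ.+ t <_) (sym (2^-double m)) (ℕ.+-monoʳ-< (2 ^ m) t<2^m))

coeffF-double : ∀ m → coeffF (2 ^ m ℕ.+ 2 ^ m) ≡ 1ℤ
coeffF-double m = trans (cong coeffF (sym (2^-double m))) (coeffF-pow (suc m))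

principal : List ℕ → ℤ
principal L = minor (hankelMatrix coeffF) L L

H : ℕ → ℤ
H n = principal (range 0 n)

-- G n = Hₙ of the series Σ a_{k+2} xᵏ, i.e. rows and columns 1, …, n of the Hankel matrix of f.
G : ℕ → ℤ
G n = principal (range 1 n)

-- In the window s, …, s + 2q + 2 centred at 2ᵐ, the top index y = 2ᵐ + q + 1 meets only the bottom
-- index s on the antidiagonal y + s = 2ᵐ⁺¹: smaller indices give sums in (2ᵐ, 2ᵐ⁺¹), larger ones
-- sums in (2ᵐ⁺¹, 2ᵐ⁺²).
module _ (m q s : ℕ) (s+q+1≡2^m : s ℕ.+ suc q ≡ 2 ^ m) where

  coeffF-outer-corner : coeffF (suc s ℕ.+ (q ℕ.+ suc q) ℕ.+ s) ≡ 1ℤ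
  coeffF-outer-corner =
    trans (cong coeffF (trans (twice s q) (cong₂ ℕ._+_ s+q+1≡2^m s+q+1≡2^m))) (coeffF-double m)
    where
    twice : ∀ s q → suc s ℕ.+ (q ℕ.+ suc q) ℕ.+ s ≡ s ℕ.+ suc q ℕ.+ (s ℕ.+ suc q)
    twice = ℕ-Solver.solve-∀

  coeffF-outer-below : ∀ z → z < s → coeffF (suc s ℕ.+ (q ℕ.+ suc q) ℕ.+ z) ≡ 0ℤ
  coeffF-outer-below z z<s =
    trans (cong coeffF (trans (shift s q z) (cong (ℕ._+ (suc q ℕ.+ z)) s+q+1≡2^m)))
          (coeffF-above m (suc q ℕ.+ z) (s≤s z≤n)
             (subst (suc q ℕ.+ z <_) (trans (ℕ.+-comm (suc q) s) s+q+1≡2^m) (ℕ.+-monoʳ-< (suc q) z<s)))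
    where
    shift : ∀ s q z → suc s ℕ.+ (q ℕ.+ suc q) ℕ.+ z ≡ s ℕ.+ suc q ℕ.+ (suc q ℕ.+ z)
    shift = ℕ-Solver.solve-∀

  coeffF-outer-above : 0 < s → ∀ i → i ≤ q ℕ.+ suc q → coeffF (suc s ℕ.+ (q ℕ.+ suc q) ℕ.+ (suc s ℕ.+ i)) ≡ 0ℤ
  coeffF-outer-above 0<s i i≤2q+1 =
    trans (cong coeffF (trans (shift s q i) (cong (ℕ._+ suc i) 2[s+q+1]≡2^1+m)))
          (coeffF-above (suc m) (suc i) (s≤s z≤n)
             (subst (suc i <_) 2[s+q+1]≡2^1+m
                    (ℕ.≤-<-trans (s≤s i≤2q+1) (ℕ.+-mono-< q+1<s+q+1 q+1<s+q+1))))
    where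
    q+1<s+q+1 : suc q < s ℕ.+ suc q
    q+1<s+q+1 = ℕ.m<n+m (suc q) 0<s
    2[s+q+1]≡2^1+m : s ℕ.+ suc q ℕ.+ (s ℕ.+ suc q) ≡ 2 ^ suc m
    2[s+q+1]≡2^1+m = trans (cong₂ ℕ._+_ s+q+1≡2^m s+q+1≡2^m) (sym (2^-double m))
    shift : ∀ s q i → suc s ℕ.+ (q ℕ.+ suc q) ℕ.+ (suc s ℕ.+ i) ≡ s ℕ.+ suc q ℕ.+ (s ℕ.+ suc q) ℕ.+ suc i
    shift = ℕ-Solver.solve-∀

window-peel : ∀ m P q s → s ℕ.+ q ≡ 2 ^ m → 0 < s → (∀ z → z ∈ P → z < s) →
              principal (P ++ range s (q ℕ.+ suc q)) ≡ sgn q * principal (P ++ 2 ^ m ∷ [])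
window-peel m P zero s s+0≡2^m _ _ =
  trans (cong (λ t → principal (P ++ t ∷ [])) (trans (sym (ℕ.+-identityʳ s)) s+0≡2^m))
        (sym (ℤ.*-identityˡ _))
window-peel m P (suc q) s s+q+1≡2^m 0<s P<s = begin
  principal (P ++ s ∷ range (suc s) (q ℕ.+ suc (suc q)))
    ≡⟨ cong (λ W → principal (P ++ s ∷ W))
            (trans (cong (range (suc s)) (ℕ.+-suc q (suc q))) (range-∷ʳ (suc s) (q ℕ.+ suc q))) ⟩
  principal (P ++ s ∷ B ++ y ∷ [])
    ≡⟨ minor-pair-elim (hankelMatrix coeffF) P s B y row≡0 column≡0 ⟩
  - (coeffF (y ℕ.+ s) * coeffF (s ℕ.+ y)) * principal (P ++ B)
    ≡⟨ cong₂ (λ u v → - (u * v) * principal (P ++ B))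
             (coeffF-outer-corner m q s s+q+1≡2^m)
             (trans (cong coeffF (ℕ.+-comm s y)) (coeffF-outer-corner m q s s+q+1≡2^m)) ⟩
  -1ℤ * principal (P ++ B)
    ≡⟨ cong (-1ℤ *_) (window-peel m P q (suc s) (trans (sym (ℕ.+-suc s q)) s+q+1≡2^m) (s≤s z≤n)
                                  (λ z → ℕ.m<n⇒m<1+n ∘ P<s z)) ⟩
  -1ℤ * (sgn q * principal (P ++ 2 ^ m ∷ []))
    ≡⟨ negate (sgn q) (principal (P ++ 2 ^ m ∷ [])) ⟩
  - sgn q * principal (P ++ 2 ^ m ∷ [])
    ∎
  where
  B = range (suc s) (q ℕ.+ suc q)
  y = suc s ℕ.+ (q ℕ.+ suc q)

  negate : ∀ t x → -1ℤ * (t * x) ≡ - t * x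
  negate = solve-∀

  row≡0 : ∀ z → z ∈ P ++ B ++ y ∷ [] → coeffF (y ℕ.+ z) ≡ 0ℤ
  row≡0 z z∈ with ∈-++⁻ P z∈
  ... | inj₁ z∈P = coeffF-outer-below m q s s+q+1≡2^m z (P<s z z∈P)
  ... | inj₂ z∈B+y with ∈-++⁻ B z∈B+y
  ...   | inj₂ (here refl) = coeffF-outer-above m q s s+q+1≡2^m 0<s (q ℕ.+ suc q) ℕ.≤-refl
  ...   | inj₁ z∈B with ∈-range⁻ (suc s) (q ℕ.+ suc q) z∈B
  ...     | i , i<2q+1 , refl = coeffF-outer-above m q s s+q+1≡2^m 0<s i (ℕ.<⇒≤ i<2q+1)

  column≡0 : ∀ z → z ∈ P ++ B → coeffF (z ℕ.+ y) ≡ 0ℤ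
  column≡0 z z∈ = trans (cong coeffF (ℕ.+-comm z y))
                        (row≡0 z (subst (z ∈_) (++-assoc P B (y ∷ [])) (∈-++⁺ˡ z∈)))

coeffF-above-range : ∀ m w z → w < 2 ^ m → z ∈ range 1 w → coeffF (2 ^ m ℕ.+ z) ≡ 0ℤ
coeffF-above-range m w z w<2^m z∈ with ∈-range⁻ 1 w z∈
... | i , i<w , refl = coeffF-above m (suc i) (s≤s z≤n) (ℕ.≤-<-trans i<w w<2^m)

G-base : ∀ m w → w < 2 ^ m → principal (range 1 w ++ 2 ^ m ∷ []) ≡ G w
G-base m w w<2^m = begin
  principal (range 1 w ++ 2 ^ m ∷ [])
    ≡⟨ minor-border (hankelMatrix coeffF) (range 1 w) (2 ^ m) (λ z → coeffF-above-range m w z w<2^m) ⟩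
  coeffF (2 ^ m ℕ.+ 2 ^ m) * G w
    ≡⟨ cong (_* G w) (coeffF-double m) ⟩
  1ℤ * G w
    ≡⟨ ℤ.*-identityˡ (G w) ⟩
  G w
    ∎

H-base : ∀ m w → w < 2 ^ m → principal (range 0 (suc w) ++ 2 ^ m ∷ []) ≡ H (suc w) - G w
H-base m w w<2^m = begin
  principal (0 ∷ range 1 w ++ 2 ^ m ∷ [])
    ≡⟨ minor-border-corner (hankelMatrix coeffF) 0 (range 1 w) (2 ^ m)
         (λ z → coeffF-above-range m w z w<2^m)
         (λ z z∈ → trans (cong coeffF (ℕ.+-comm z (2 ^ m))) (coeffF-above-range m w z w<2^m z∈)) ⟩
  coeffF (2 ^ m ℕ.+ 2 ^ m) * H (suc w) - coeffF (2 ^ m ℕ.+ 0) * coeffF (2 ^ m) * G w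
    ≡⟨ cong₂ (λ u v → u * H (suc w) - v * coeffF (2 ^ m) * G w)
             (coeffF-double m) (cong coeffF (ℕ.+-identityʳ (2 ^ m))) ⟩
  1ℤ * H (suc w) - coeffF (2 ^ m) * coeffF (2 ^ m) * G w
    ≡⟨ cong (λ u → 1ℤ * H (suc w) - u * u * G w) (coeffF-pow m) ⟩
  1ℤ * H (suc w) - 1ℤ * 1ℤ * G w
    ≡⟨ unit (H (suc w)) (G w) ⟩
  H (suc w) - G w
    ∎
  where
  unit : ∀ h g → 1ℤ * h - 1ℤ * 1ℤ * g ≡ h - g
  unit = solve-∀

G-recurrence : ∀ m p w → suc (p ℕ.+ w) ≡ 2 ^ m → G (2 ^ m ℕ.+ p) ≡ sgn p * G w
G-recurrence m p w p+w+1≡2^m = begin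
  principal (range 1 (2 ^ m ℕ.+ p))
    ≡⟨ cong (λ n → principal (range 1 n)) length-split ⟩
  principal (range 1 (w ℕ.+ (p ℕ.+ suc p)))
    ≡⟨ cong principal (range-++ 1 w (p ℕ.+ suc p)) ⟩
  principal (range 1 w ++ range (suc w) (p ℕ.+ suc p))
    ≡⟨ window-peel m (range 1 w) p (suc w) (trans (cong suc (ℕ.+-comm w p)) p+w+1≡2^m) (s≤s z≤n)
                   (λ z → ∈-range-< 1 w) ⟩
  sgn p * principal (range 1 w ++ 2 ^ m ∷ [])
    ≡⟨ cong (sgn p *_) (G-base m w (subst (w <_) p+w+1≡2^m (s≤s (ℕ.m≤n+m w p)))) ⟩
  sgn p * G w
    ∎
  where
  length-split : 2 ^ m ℕ.+ p ≡ w ℕ.+ (p ℕ.+ suc p)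
  length-split = trans (cong (ℕ._+ p) (sym p+w+1≡2^m)) (rearrange p w)
    where
    rearrange : ∀ p w → suc (p ℕ.+ w) ℕ.+ p ≡ w ℕ.+ (p ℕ.+ suc p)
    rearrange = ℕ-Solver.solve-∀

H-recurrence : ∀ m p w → suc (p ℕ.+ w) ≡ 2 ^ m → H (suc (2 ^ m ℕ.+ p)) ≡ sgn p * (H (suc w) - G w)
H-recurrence m p w p+w+1≡2^m = begin
  principal (range 0 (suc (2 ^ m ℕ.+ p)))
    ≡⟨ cong (λ n → principal (range 0 n)) length-split ⟩
  principal (range 0 (suc w ℕ.+ (p ℕ.+ suc p)))
    ≡⟨ cong principal (range-++ 0 (suc w) (p ℕ.+ suc p)) ⟩
  principal (range 0 (suc w) ++ range (suc w) (p ℕ.+ suc p))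
    ≡⟨ window-peel m (range 0 (suc w)) p (suc w) (trans (cong suc (ℕ.+-comm w p)) p+w+1≡2^m) (s≤s z≤n)
                   (λ z → ∈-range-< 0 (suc w)) ⟩
  sgn p * principal (range 0 (suc w) ++ 2 ^ m ∷ [])
    ≡⟨ cong (sgn p *_) (H-base m w (subst (w <_) p+w+1≡2^m (s≤s (ℕ.m≤n+m w p)))) ⟩
  sgn p * (H (suc w) - G w)
    ∎
  where
  length-split : suc (2 ^ m ℕ.+ p) ≡ suc w ℕ.+ (p ℕ.+ suc p)
  length-split = trans (cong (λ n → suc (n ℕ.+ p)) (sym p+w+1≡2^m)) (rearrange p w)
    where
    rearrange : ∀ p w → suc (suc (p ℕ.+ w) ℕ.+ p) ≡ suc w ℕ.+ (p ℕ.+ suc p)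
    rearrange = ℕ-Solver.solve-∀

jAux-zero : ∀ f → jAux f 0 ≡ 0ℤ
jAux-zero zero    = refl
jAux-zero (suc f) = jAux-zero f

jAux-fuel : ∀ {f g} n → n < f → n < g → jAux f n ≡ jAux g n
jAux-fuel {f} {g} zero _ _ = trans (jAux-zero f) (sym (jAux-zero g))
jAux-fuel {suc f} {suc g} (suc n) (s≤s n<f) (s≤s n<g) with suc n % 2
... | zero  = jAux-fuel (suc n / 2) (ℕ.<-≤-trans half< n<f) (ℕ.<-≤-trans half< n<g)
  where half< = m/n<m (suc n) 2 (s≤s (s≤s z≤n))
... | suc _ = refl

jAux-even : ∀ f n → n % 2 ≡ 0 → jAux (suc f) n ≡ jAux f (n / 2)
jAux-even f n n%2≡0 with n % 2
... | zero = refl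

jAux-odd : ∀ f n → n % 2 ≡ 1 → jAux (suc f) n ≡ sgn (n / 2)
jAux-odd f n n%2≡1 with n % 2
... | suc _ = refl

j-even : ∀ i → 0 < i → jseq (2 ℕ.* i) ≡ jseq i
j-even i 0<i = begin
  jAux (suc (2 ℕ.* i)) (2 ℕ.* i)
    ≡⟨ jAux-even (2 ℕ.* i) (2 ℕ.* i) (trans (cong (_% 2) (ℕ.*-comm 2 i)) (m*n%n≡0 i 2)) ⟩
  jAux (2 ℕ.* i) (2 ℕ.* i / 2)
    ≡⟨ cong (jAux (2 ℕ.* i)) (trans (cong (_/ 2) (ℕ.*-comm 2 i)) (m*n/n≡m i 2)) ⟩
  jAux (2 ℕ.* i) i
    ≡⟨ jAux-fuel i (ℕ.m<m+n i (subst (0 <_) (sym (ℕ.+-identityʳ i)) 0<i)) ℕ.≤-refl ⟩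
  jseq i
    ∎

j-odd : ∀ i → jseq (suc (2 ℕ.* i)) ≡ sgn i
j-odd i = begin
  jAux (suc (suc (2 ℕ.* i))) (suc (2 ℕ.* i))
    ≡⟨ jAux-odd (suc (2 ℕ.* i)) (suc (2 ℕ.* i)) (trans (cong (_% 2) 1+2i≡1+i*2) ([m+kn]%n≡m%n 1 i 2)) ⟩
  sgn (suc (2 ℕ.* i) / 2)
    ≡⟨ cong sgn (trans (cong (_/ 2) 1+2i≡1+i*2) (trans (+-distrib-/ 1 (i ℕ.* 2) no-carry) (m*n/n≡m i 2))) ⟩
  sgn i
    ∎
  where
  1+2i≡1+i*2 : suc (2 ℕ.* i) ≡ 1 ℕ.+ i ℕ.* 2
  1+2i≡1+i*2 = cong suc (ℕ.*-comm 2 i)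
  no-carry : 1 % 2 ℕ.+ i ℕ.* 2 % 2 < 2
  no-carry = subst (λ r → 1 ℕ.+ r < 2) (sym (m*n%n≡0 i 2)) ℕ.≤-refl

j-pow : ∀ k → jseq (2 ^ k) ≡ 1ℤ
j-pow zero    = refl
j-pow (suc k) = trans (j-even (2 ^ k) (ℕ.m^n>0 2 k)) (j-pow k)

data Parity : ℕ → Set where
  even : ∀ i → Parity (2 ℕ.* i)
  odd  : ∀ i → Parity (suc (2 ℕ.* i))

parity : ∀ n → Parity n
parity zero = even 0
parity (suc n) with parity n
... | even i = odd i
... | odd i  = subst Parity (ℕ.*-distribˡ-+ 2 1 i) (even (suc i))

sgn-complement : ∀ a b c → a ℕ.+ suc b ≡ c ℕ.+ c → sgn a ≡ - sgn b
sgn-complement a b c a+1+b≡2c = begin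
  sgn a
    ≡⟨ ℤ.*-identityʳ (sgn a) ⟨
  sgn a * 1ℤ
    ≡⟨ cong (sgn a *_) (sgn-square (suc b)) ⟨
  sgn a * (sgn (suc b) * sgn (suc b))
    ≡⟨ ℤ.*-assoc (sgn a) (sgn (suc b)) (sgn (suc b)) ⟨
  sgn a * sgn (suc b) * sgn (suc b)
    ≡⟨ cong (_* sgn (suc b)) (trans (sym (sgn-+ a (suc b))) (trans (cong sgn a+1+b≡2c) (sgn-double c))) ⟩
  1ℤ * sgn (suc b)
    ≡⟨ ℤ.*-identityˡ (sgn (suc b)) ⟩
  - sgn b
    ∎

j-reflect : ∀ k d e → d ℕ.+ e ≡ 2 ^ k → 0 < d → 0 < e → jseq (2 ^ k ℕ.+ d) ≡ - jseq e
j-reflect zero (suc d) (suc e) 1+d+1+e≡1 _ _ = contradiction (ℕ.suc-injective 1+d+1+e≡1) (ℕ.m+1+n≢0 d)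
j-reflect (suc k) d e d+e≡2^1+k 0<d 0<e with parity d | parity e
... | even i | even i′ = begin
  jseq (2 ℕ.* 2 ^ k ℕ.+ 2 ℕ.* i)
    ≡⟨ cong jseq (ℕ.*-distribˡ-+ 2 (2 ^ k) i) ⟨
  jseq (2 ℕ.* (2 ^ k ℕ.+ i))
    ≡⟨ j-even (2 ^ k ℕ.+ i) (ℕ.<-≤-trans (ℕ.m^n>0 2 k) (ℕ.m≤m+n (2 ^ k) i)) ⟩
  jseq (2 ^ k ℕ.+ i)
    ≡⟨ j-reflect k i i′ (ℕ.*-cancelˡ-≡ (i ℕ.+ i′) (2 ^ k) 2 (trans (ℕ.*-distribˡ-+ 2 i i′) d+e≡2^1+k))
                 (half-pos i 0<d) (half-pos i′ 0<e) ⟩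
  - jseq i′
    ≡⟨ cong -_ (j-even i′ (half-pos i′ 0<e)) ⟨
  - jseq (2 ℕ.* i′)
    ∎
  where
  half-pos : ∀ i → 0 < 2 ℕ.* i → 0 < i
  half-pos (suc i) _ = s≤s z≤n
... | odd i | odd i′ = begin
  jseq (2 ℕ.* 2 ^ k ℕ.+ suc (2 ℕ.* i))
    ≡⟨ cong jseq (trans (ℕ.+-suc (2 ℕ.* 2 ^ k) (2 ℕ.* i)) (cong suc (sym (ℕ.*-distribˡ-+ 2 (2 ^ k) i)))) ⟩
  jseq (suc (2 ℕ.* (2 ^ k ℕ.+ i)))
    ≡⟨ j-odd (2 ^ k ℕ.+ i) ⟩
  sgn (2 ^ k ℕ.+ i)
    ≡⟨ sgn-complement (2 ^ k ℕ.+ i) i′ (2 ^ k)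
                      (trans (ℕ.+-assoc (2 ^ k) i (suc i′)) (cong (2 ^ k ℕ.+_) i+1+i′≡2^k)) ⟩
  - sgn i′
    ≡⟨ cong -_ (j-odd i′) ⟨
  - jseq (suc (2 ℕ.* i′))
    ∎
  where
  i+1+i′≡2^k : i ℕ.+ suc i′ ≡ 2 ^ k
  i+1+i′≡2^k = ℕ.*-cancelˡ-≡ (i ℕ.+ suc i′) (2 ^ k) 2 (trans (double i i′) d+e≡2^1+k)
    where
    double : ∀ i i′ → 2 ℕ.* (i ℕ.+ suc i′) ≡ suc (2 ℕ.* i) ℕ.+ suc (2 ℕ.* i′)
    double = ℕ-Solver.solve-∀
... | even i | odd i′ =
  contradiction (trans (sym d+e≡2^1+k)
                       (trans (ℕ.+-suc (2 ℕ.* i) (2 ℕ.* i′)) (cong suc (sym (ℕ.*-distribˡ-+ 2 i i′)))))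
                (ℕ.even≢odd (2 ^ k) (i ℕ.+ i′))
... | odd i | even i′ =
  contradiction (trans (sym d+e≡2^1+k) (cong suc (sym (ℕ.*-distribˡ-+ 2 i i′))))
                (ℕ.even≢odd (2 ^ k) (i ℕ.+ i′))

J : ℕ → ℤ
J n = Σℤ (suc n) jseq

J-reflect : ∀ k d e → suc (d ℕ.+ e) ≡ 2 ^ k → J (2 ^ k ℕ.+ d) ≡ J e + 1ℤ
J-reflect k zero e 1+e≡2^k = begin
  J (2 ^ k ℕ.+ 0)
    ≡⟨ cong J (trans (ℕ.+-identityʳ (2 ^ k)) (sym 1+e≡2^k)) ⟩
  J e + jseq (suc e)
    ≡⟨ cong (_+_ (J e)) (trans (cong jseq 1+e≡2^k) (j-pow k)) ⟩
  J e + 1ℤ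
    ∎
J-reflect k (suc d) e 2+d+e≡2^k = begin
  J (2 ^ k ℕ.+ suc d)
    ≡⟨ cong J (ℕ.+-suc (2 ^ k) d) ⟩
  J (2 ^ k ℕ.+ d) + jseq (suc (2 ^ k ℕ.+ d))
    ≡⟨ cong₂ _+_ (J-reflect k d (suc e) 1+d+1+e≡2^k) (cong jseq (sym (ℕ.+-suc (2 ^ k) d))) ⟩
  J e + jseq (suc e) + 1ℤ + jseq (2 ^ k ℕ.+ suc d)
    ≡⟨ cong (_+_ (J e + jseq (suc e) + 1ℤ)) (j-reflect k (suc d) (suc e) 1+d+1+e≡2^k (s≤s z≤n) (s≤s z≤n)) ⟩
  J e + jseq (suc e) + 1ℤ + - jseq (suc e)
    ≡⟨ cancel (J e) (jseq (suc e)) ⟩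
  J e + 1ℤ
    ∎
  where
  1+d+1+e≡2^k : suc (d ℕ.+ suc e) ≡ 2 ^ k
  1+d+1+e≡2^k = trans (cong suc (ℕ.+-suc d e)) 2+d+e≡2^k
  cancel : ∀ x y → x + y + 1ℤ + - y ≡ x + 1ℤ
  cancel = solve-∀

record Mirror (n : ℕ) : Set where
  field
    k p w     : ℕ
    2^k+p≡n   : 2 ^ k ℕ.+ p ≡ n
    p+w+1≡2^k : suc (p ℕ.+ w) ≡ 2 ^ k

  w<n : w < n
  w<n = ℕ.<-≤-trans (subst (w <_) p+w+1≡2^k (s≤s (ℕ.m≤n+m w p)))
                     (subst (2 ^ k ≤_) 2^k+p≡n (ℕ.m≤m+n (2 ^ k) p))

mirror : ∀ n → Mirror (suc n)
mirror zero = record { k = 0 ; p = 0 ; w = 0 ; 2^k+p≡n = refl ; p+w+1≡2^k = refl }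
mirror (suc n) with mirror n
... | record { k = k ; p = p ; w = suc w ; 2^k+p≡n = 2^k+p≡1+n ; p+w+1≡2^k = p+w+2≡2^k } = record
  { k = k ; p = suc p ; w = w
  ; 2^k+p≡n   = trans (ℕ.+-suc (2 ^ k) p) (cong suc 2^k+p≡1+n)
  ; p+w+1≡2^k = trans (cong suc (sym (ℕ.+-suc p w))) p+w+2≡2^k }
... | record { k = k ; p = p ; w = zero ; 2^k+p≡n = 2^k+p≡1+n ; p+w+1≡2^k = p+1≡2^k } = record
  { k = suc k ; p = 0 ; w = suc n
  ; 2^k+p≡n   = trans (ℕ.+-identityʳ (2 ^ suc k)) (sym 2+n≡2^1+k)
  ; p+w+1≡2^k = 2+n≡2^1+k }
  where
  2+n≡2^1+k : suc (suc n) ≡ 2 ^ suc k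
  2+n≡2^1+k = begin
    suc (suc n)       ≡⟨ cong suc 2^k+p≡1+n ⟨
    suc (2 ^ k ℕ.+ p) ≡⟨ ℕ.+-suc (2 ^ k) p ⟨
    2 ^ k ℕ.+ suc p   ≡⟨ cong (λ q → 2 ^ k ℕ.+ suc q) (ℕ.+-identityʳ p) ⟨
    2 ^ k ℕ.+ suc (p ℕ.+ 0) ≡⟨ cong (2 ^ k ℕ.+_) p+1≡2^k ⟩
    2 ^ k ℕ.+ 2 ^ k   ≡⟨ 2^-double k ⟨
    2 ^ suc k         ∎

mirror-induction : (P : ℕ → Set) → P 0 → (∀ k p w → suc (p ℕ.+ w) ≡ 2 ^ k → P w → P (2 ^ k ℕ.+ p)) →
                   ∀ n → P n
mirror-induction P base step = <-rec P induct
  where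
  induct : ∀ n → (∀ {m} → m < n → P m) → P n
  induct zero    _   = base
  induct (suc n) rec = subst P 2^k+p≡n (step k p w p+w+1≡2^k (rec w<n))
    where open Mirror (mirror n)

G-unit : ∀ n → ∣ G n ∣ ≡ 1
G-unit = mirror-induction (λ n → ∣ G n ∣ ≡ 1) refl λ k p w p+w+1≡2^k ∣Gw∣≡1 → begin
  ∣ G (2 ^ k ℕ.+ p) ∣       ≡⟨ cong ∣_∣ (G-recurrence k p w p+w+1≡2^k) ⟩
  ∣ sgn p * G w ∣           ≡⟨ ℤ.∣i*j∣≡∣i∣*∣j∣ (sgn p) (G w) ⟩
  ∣ sgn p ∣ ℕ.* ∣ G w ∣     ≡⟨ cong₂ ℕ._*_ (∣sgn∣≡1 p) ∣Gw∣≡1 ⟩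
  1                         ∎
  where
  ∣sgn∣≡1 : ∀ n → ∣ sgn n ∣ ≡ 1
  ∣sgn∣≡1 zero    = refl
  ∣sgn∣≡1 (suc n) = trans (ℤ.∣-i∣≡∣i∣ (sgn n)) (∣sgn∣≡1 n)

H-formula : ∀ n → H (suc n) ≡ - (G n * (J n - 1ℤ))
H-formula = mirror-induction (λ n → H (suc n) ≡ - (G n * (J n - 1ℤ))) refl
  λ k p w p+w+1≡2^k Hw≡ → begin
    H (suc (2 ^ k ℕ.+ p))
      ≡⟨ H-recurrence k p w p+w+1≡2^k ⟩
    sgn p * (H (suc w) - G w)
      ≡⟨ cong (λ h → sgn p * (h - G w)) Hw≡ ⟩
    sgn p * (- (G w * (J w - 1ℤ)) - G w)
      ≡⟨ regroup (sgn p) (G w) (J w) ⟩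
    - (sgn p * G w * (J w + 1ℤ - 1ℤ))
      ≡⟨ cong₂ (λ g j → - (g * (j - 1ℤ))) (G-recurrence k p w p+w+1≡2^k) (J-reflect k p w p+w+1≡2^k) ⟨
    - (G (2 ^ k ℕ.+ p) * (J (2 ^ k ℕ.+ p) - 1ℤ))
      ∎
  where
  regroup : ∀ s g j → s * (- (g * (j - 1ℤ)) - g) ≡ - (s * g * (j + 1ℤ - 1ℤ))
  regroup = solve-∀

J-nonneg : ∀ n → 0ℤ ℤ.≤ J n
J-nonneg = mirror-induction (λ n → 0ℤ ℤ.≤ J n) ℤ.≤-refl λ k p w p+w+1≡2^k 0≤Jw →
  subst (0ℤ ℤ.≤_) (sym (J-reflect k p w p+w+1≡2^k)) (ℤ.≤-trans 0≤Jw (ℤ.i≤i+j (J w) 1ℤ))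

J-positive : ∀ n → 1ℤ ℤ.≤ J (suc n)
J-positive n = subst (1ℤ ℤ.≤_) (trans (sym (J-reflect k p w p+w+1≡2^k)) (cong J 2^k+p≡n))
                     (ℤ.+-monoˡ-≤ 1ℤ (J-nonneg w))
  where open Mirror (mirror n)

theorem32 : (n : ℕ) → 1 Data.Nat.≤ n → + ∣ hankel coeffF (suc n) ∣ ≡ sseq n - + 2
theorem32 (suc n) (s≤s z≤n) = begin
  + ∣ hankel coeffF (suc (suc n)) ∣
    ≡⟨ cong (λ h → + ∣ h ∣) (trans (hankel-minor coeffF (suc (suc n))) (H-formula (suc n))) ⟩
  + ∣ - (G (suc n) * (J (suc n) - 1ℤ)) ∣
    ≡⟨ cong +_ (abs-neg-unit (G (suc n)) (J (suc n) - 1ℤ) (G-unit (suc n))) ⟩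
  + ∣ J (suc n) - 1ℤ ∣
    ≡⟨ ℤ.0≤i⇒+∣i∣≡i (ℤ.i≤j⇒0≤j-i (J-positive n)) ⟩
  J (suc n) - 1ℤ
    ≡⟨ shift (J (suc n)) ⟩
  sseq (suc n) - + 2
    ∎
  where
  abs-neg-unit : ∀ u x → ∣ u ∣ ≡ 1 → ∣ - (u * x) ∣ ≡ ∣ x ∣
  abs-neg-unit u x ∣u∣≡1 =
    trans (ℤ.∣-i∣≡∣i∣ (u * x))
          (trans (ℤ.∣i*j∣≡∣i∣*∣j∣ u x) (trans (cong (ℕ._* ∣ x ∣) ∣u∣≡1) (ℕ.*-identityˡ ∣ x ∣)))
  shift : ∀ j → j - 1ℤ ≡ 1ℤ + j - + 2
  shift = solve-∀
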